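{- Let $p$ be a prime, $n\ge1$, and $M=(a_{i,j})\in M^{n\times n}(\mathbb{F}_p)$ a nonsingular matrix. For $i\in[n]$ let $0\le r_i,s_i\le p-1$ be integers with $\sum_is_i=\sum_ir_i$. Then $$\mathrm{Coeff}\Big(\prod_{i}x_i^{s_i},\ \overline{\prod_{i}\Big(\sum_{j}a_{i,j}x_j\Big)^{r_i}}\Big)=0$$ if and only if $$\mathrm{Coeff}\Big(\prod_{j}x_j^{r_j},\ \overline{\prod_{j}\Big(\sum_{i}a_{i,j}x_i\Big)^{s_j}}\Big)=0.$$
   Context: For $f\in\mathbb{F}_p[x_1,\dots,x_n]$, $\overline f$ is its reduced form (degree $\le p-1$ in each variable, obtained by replacing $x^{i(p-1)+j}$ by $x^j$ when $i>0$, $0<j<p$), and $\mathrm{Coeff}(\prod x_i^{b_i},f)$ denotes the coefficient of that monomial in $f$. -}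

module Defs where

open import Data.Nat using (ℕ; zero; suc; _+_; _*_; _∸_; _%_; NonZero)
open import Data.Nat.Primality using (Prime; prime⇒nonZero)
open import Data.Nat.Properties using (_≟_)
import Data.Nat.ListAction
open import Data.Fin using (Fin; toℕ)
import Data.Fin.Properties as FinP
open import Data.Vec as Vec using (Vec)
import Data.Vec.Properties as VecP
open import Data.List as List using (List; []; _∷_)
open import Data.Product using (_×_; _,_; ∃)
open import Relation.Nullary using (yes; no)
open import Relation.Binary.PropositionalEquality using (_≡_)

-- Coefficients are later
-- read in F_p via reduction mod p (ℕ → F_p is a ring homomorphism and
-- coefficient extraction is additive, so this is faithful).
Term : ℕ → Set
Term n = ℕ × Vec ℕ n

Poly : ℕ → Set
Poly n = List (Term n)

one : ∀ {n} → Poly n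
one = (1 , Vec.replicate _ 0) ∷ []

mul : ∀ {n} → Poly n → Poly n → Poly n
mul f g = List.concatMap (λ { (c , e) → List.map (λ { (d , e′) → (c * d , Vec.zipWith _+_ e e′) }) g }) f

pow : ∀ {n} → Poly n → ℕ → Poly n
pow f zero    = one
pow f (suc k) = mul f (pow f k)

prodFin : ∀ {n} → (Fin n → Poly n) → Poly n
prodFin {n} F = List.foldr mul one (List.tabulate F)

δ : ∀ {n} → Fin n → Fin n → ℕ
δ i k with FinP._≟_ i k
... | yes _ = 1
... | no  _ = 0

unitExp : ∀ {n} → Fin n → Vec ℕ n
unitExp j = Vec.tabulate (δ j)

linForm : ∀ {n} → (Fin n → ℕ) → Poly n
linForm c = List.tabulate (λ j → (c j , unitExp j))

-- reduction of a single exponent: x^{i(p-1)+j} ↦ x^j for i>0, 0<j<p.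
-- For e = 0 it gives 0; for e > 0 it gives the unique j ∈ {1,…,p-1}
-- with j ≡ e (mod p-1).  (The p ≤ 1 branch is irrelevant: p is prime.)
redExp : ℕ → ℕ → ℕ
redExp p zero = zero
redExp p (suc e) with p ∸ 1
... | zero  = suc e
... | suc q = suc (e % suc q)

reduce : ∀ {n} → ℕ → Poly n → Poly n
reduce p f = List.map (λ { (c , e) → (c , Vec.map (redExp p) e) }) f

-- Coeff(x^m , f)  (as a natural number; its image in F_p is the coefficient)
coeff : ∀ {n} → Vec ℕ n → Poly n → ℕ
coeff m [] = 0
coeff m ((c , e) ∷ f) with VecP.≡-dec _≟_ e m
... | yes _ = c + coeff m f
... | no  _ = coeff m f

IsZeroMod : ℕ → ℕ → Set
IsZeroMod p x = Data.Nat.Divisibility._∣_ p x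
  where import Data.Nat.Divisibility

sumFin : ∀ {n} → (Fin n → ℕ) → ℕ
sumFin F = Data.Nat.ListAction.sum (List.tabulate F)

matMul : ∀ {n p} → (Fin n → Fin n → Fin p) → (Fin n → Fin n → Fin p) → Fin n → Fin n → ℕ
matMul A B i k = sumFin (λ j → toℕ (A i j) * toℕ (B j k))

Nonsingular : ∀ {n} (p : ℕ) → Prime p → (Fin n → Fin n → Fin p) → Set
Nonsingular {n} p pp A =
  ∃ λ (B : Fin n → Fin n → Fin p) →
    (∀ i k → matMul A B i k % p ≡ δ i k % p) ×
    (∀ i k → matMul B A i k % p ≡ δ i k % p)
  where instance _ = prime⇒nonZero pp

-- Let ℓᵢ = Σⱼ aᵢⱼ xⱼ, let ρ list each row index i exactly rᵢ times and σ each column index j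
-- exactly sⱼ times. Expanding ∏ₖ ℓ_{ρₖ} monomial by monomial shows that s₁!⋯sₙ! times the
-- coefficient of x^s is the permanent of the |ρ|×|σ| matrix (a_{ρₖ σₗ}). A permanent is invariant
-- under transposition, so s!·Coeff(x^s, ∏ᵢ ℓᵢ^{rᵢ}) = r!·Coeff(x^r, ∏ⱼ ℓ′ⱼ^{sⱼ}) with ℓ′ⱼ = Σᵢ aᵢⱼ xᵢ,
-- and as all rᵢ, sⱼ < p, neither factorial product is divisible by p. Reduction does not change
-- these coefficients: both products are homogeneous of degree Σrᵢ = Σsⱼ, reduction strictly lowers
-- the degree of every monomial it alters, and x^s, x^r are already reduced.
module Submission where

open import Defs
open import Data.Fin using (Fin; toℕ; zero; suc)
import Data.Fin.Properties as Finₚ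
open import Data.List as List using (List; []; _∷_; _++_; length)
import Data.List.Properties as Listₚ
open import Data.List.Relation.Unary.All as All using (All; []; _∷_)
import Data.List.Relation.Unary.All.Properties as Allₚ
open import Data.Nat
open import Data.Nat.Divisibility using (_∣_; _∤_; ∣1⇒≡1; >⇒∤; ∣n⇒∣m*n)
open import Data.Nat.DivMod using (m%n≤m; m<n⇒m%n≡m)
open import Data.Nat.ListAction using (sum)
open import Data.Nat.Primality using (Prime; euclidsLemma; prime⇒nonTrivial)
open import Data.Nat.Properties
open import Algebra.Properties.CommutativeSemigroup +-commutativeSemigroup
  using () renaming (interchange to +-interchange; x∙yz≈y∙xz to +-left-comm)
open import Algebra.Properties.CommutativeSemigroup *-commutativeSemigroup
  using () renaming (x∙yz≈y∙xz to *-left-comm)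
open import Data.Nat.Solver using (module +-*-Solver)
open +-*-Solver using (solve; _:*_; _:=_)
open import Data.Product using (_×_; _,_; proj₁; proj₂; map₂)
open import Data.Sum using (inj₁; inj₂)
open import Data.Vec as Vec using (Vec; []; _∷_; _[_]%=_; tabulate)
import Data.Vec.Properties as Vecₚ
open import Function using (_∘_; flip)
open import Function.Bundles using (_⇔_; mk⇔)
open import Relation.Binary.PropositionalEquality
open import Relation.Nullary using (yes; no; contradiction)

mulTerm : ∀ {n} → Term n → Term n → Term n
mulTerm (c , e) (d , e′) = c * d , Vec.zipWith _+_ e e′

zipWith-+-assoc : ∀ {n} (x y z : Vec ℕ n) →
                  Vec.zipWith _+_ (Vec.zipWith _+_ x y) z ≡ Vec.zipWith _+_ x (Vec.zipWith _+_ y z)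
zipWith-+-assoc []      []      []      = refl
zipWith-+-assoc (a ∷ x) (b ∷ y) (c ∷ z) = cong₂ _∷_ (+-assoc a b c) (zipWith-+-assoc x y z)

zipWith-+-identityˡ : ∀ {n} (x : Vec ℕ n) → Vec.zipWith _+_ (Vec.replicate n 0) x ≡ x
zipWith-+-identityˡ []      = refl
zipWith-+-identityˡ (a ∷ x) = cong (a ∷_) (zipWith-+-identityˡ x)

zipWith-+-identityʳ : ∀ {n} (x : Vec ℕ n) → Vec.zipWith _+_ x (Vec.replicate n 0) ≡ x
zipWith-+-identityʳ []      = refl
zipWith-+-identityʳ (a ∷ x) = cong₂ _∷_ (+-identityʳ a) (zipWith-+-identityʳ x)

mulTerm-assoc : ∀ {n} (t u v : Term n) → mulTerm (mulTerm t u) v ≡ mulTerm t (mulTerm u v)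
mulTerm-assoc (c , e) (d , e′) (f , e″) = cong₂ _,_ (*-assoc c d f) (zipWith-+-assoc e e′ e″)

mul-distribʳ-++ : ∀ {n} (f f′ g : Poly n) → mul (f ++ f′) g ≡ mul f g ++ mul f′ g
mul-distribʳ-++ []      f′ g = refl
mul-distribʳ-++ (t ∷ f) f′ g = begin
  List.map (mulTerm t) g ++ mul (f ++ f′) g         ≡⟨ cong (List.map (mulTerm t) g ++_) (mul-distribʳ-++ f f′ g) ⟩
  List.map (mulTerm t) g ++ (mul f g ++ mul f′ g)   ≡⟨ Listₚ.++-assoc (List.map (mulTerm t) g) (mul f g) (mul f′ g) ⟨
  (List.map (mulTerm t) g ++ mul f g) ++ mul f′ g   ∎
  where open ≡-Reasoning

mul-map-mulTerm : ∀ {n} (t : Term n) (g h : Poly n) → mul (List.map (mulTerm t) g) h ≡ List.map (mulTerm t) (mul g h)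
mul-map-mulTerm t []      h = refl
mul-map-mulTerm t (u ∷ g) h = begin
  List.map (mulTerm (mulTerm t u)) h ++ mul (List.map (mulTerm t) g) h
    ≡⟨ cong₂ _++_ (trans (Listₚ.map-cong (mulTerm-assoc t u) h) (Listₚ.map-∘ h)) (mul-map-mulTerm t g h) ⟩
  List.map (mulTerm t) (List.map (mulTerm u) h) ++ List.map (mulTerm t) (mul g h)
    ≡⟨ Listₚ.map-++ (mulTerm t) (List.map (mulTerm u) h) (mul g h) ⟨
  List.map (mulTerm t) (List.map (mulTerm u) h ++ mul g h)
    ∎
  where open ≡-Reasoning

mul-assoc : ∀ {n} (f g h : Poly n) → mul (mul f g) h ≡ mul f (mul g h)
mul-assoc []      g h = refl
mul-assoc (t ∷ f) g h = trans (mul-distribʳ-++ (List.map (mulTerm t) g) (mul f g) h)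
                              (cong₂ _++_ (mul-map-mulTerm t g h) (mul-assoc f g h))

mul-identityˡ : ∀ {n} (h : Poly n) → mul one h ≡ h
mul-identityˡ []            = refl
mul-identityˡ ((d , e) ∷ h) = cong₂ _∷_ (cong₂ _,_ (+-identityʳ d) (zipWith-+-identityˡ e)) (mul-identityˡ h)

prod : ∀ {n} → List (Poly n) → Poly n
prod = List.foldr mul one

prod-++ : ∀ {n} (fs gs : List (Poly n)) → prod (fs ++ gs) ≡ mul (prod fs) (prod gs)
prod-++ []       gs = sym (mul-identityˡ (prod gs))
prod-++ (f ∷ fs) gs = trans (cong (mul f) (prod-++ fs gs)) (sym (mul-assoc f (prod fs) (prod gs)))

prod-concat : ∀ {n} (fss : List (List (Poly n))) → prod (List.concat fss) ≡ prod (List.map prod fss)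
prod-concat []         = refl
prod-concat (fs ∷ fss) = trans (prod-++ fs (List.concat fss)) (cong (mul (prod fs)) (prod-concat fss))

pow≡prod-replicate : ∀ {n} (f : Poly n) k → pow f k ≡ prod (List.replicate k f)
pow≡prod-replicate f zero    = refl
pow≡prod-replicate f (suc k) = cong (mul f) (pow≡prod-replicate f k)

δ-suc : ∀ {n} (i k : Fin n) → δ (suc i) (suc k) ≡ δ i k
δ-suc i k with i Finₚ.≟ k
... | yes refl = refl
... | no  _    = refl

δ-zero-suc : ∀ {n} (k : Fin n) → δ zero (suc k) ≡ 0
δ-zero-suc k with zero Finₚ.≟ suc k
... | no _ = refl

zipWith-+-tabulate-zero : ∀ {n} {f : Fin n → ℕ} → (∀ k → f k ≡ 0) → (e : Vec ℕ n) → Vec.zipWith _+_ (Vec.tabulate f) e ≡ e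
zipWith-+-tabulate-zero f≡0 []      = refl
zipWith-+-tabulate-zero f≡0 (x ∷ e) = cong₂ _∷_ (cong (_+ x) (f≡0 zero)) (zipWith-+-tabulate-zero (f≡0 ∘ suc) e)

unitExp-+ : ∀ {n} (j : Fin n) (e : Vec ℕ n) → Vec.zipWith _+_ (unitExp j) e ≡ e [ j ]%= suc
unitExp-+ zero    (x ∷ e) = cong (suc x ∷_) (zipWith-+-tabulate-zero δ-zero-suc e)
unitExp-+ (suc j) (x ∷ e) = cong (x ∷_) (trans (cong (λ v → Vec.zipWith _+_ v e) (Vecₚ.tabulate-cong (δ-suc j))) (unitExp-+ j e))

updateAt-pred∘suc : ∀ {n} (m : Vec ℕ n) j → (m [ j ]%= suc) [ j ]%= pred ≡ m
updateAt-pred∘suc m j = trans (Vecₚ.updateAt-updateAt j m) (Vecₚ.updateAt-id j m)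

updateAt-suc∘pred : ∀ {n} (m : Vec ℕ n) j {l} → Vec.lookup m j ≡ suc l → (m [ j ]%= pred) [ j ]%= suc ≡ m
updateAt-suc∘pred m j mⱼ≡1+l =
  trans (Vecₚ.updateAt-updateAt-local j m (trans (cong (λ (x : ℕ) → suc (pred x)) mⱼ≡1+l) (sym mⱼ≡1+l))) (Vecₚ.updateAt-id j m)

updateAt-suc-injective : ∀ {n} (j : Fin n) {e m : Vec ℕ n} → e [ j ]%= suc ≡ m [ j ]%= suc → e ≡ m
updateAt-suc-injective j {e} {m} eq = begin
  e                            ≡⟨ updateAt-pred∘suc e j ⟨
  (e [ j ]%= suc) [ j ]%= pred ≡⟨ cong (_[ j ]%= pred) eq ⟩
  (m [ j ]%= suc) [ j ]%= pred ≡⟨ updateAt-pred∘suc m j ⟩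
  m                            ∎
  where open ≡-Reasoning

updateAt-pred-suc-comm : ∀ {n} (m : Vec ℕ n) j k {l} → Vec.lookup m j ≡ suc l →
                         (m [ j ]%= pred) [ k ]%= suc ≡ (m [ k ]%= suc) [ j ]%= pred
updateAt-pred-suc-comm m j k mⱼ≡1+l with j Finₚ.≟ k
... | yes refl = trans (updateAt-suc∘pred m j mⱼ≡1+l) (sym (updateAt-pred∘suc m j))
... | no  j≢k  = Vecₚ.updateAt-commutes k j (j≢k ∘ sym) m

sum-zipWith-+ : ∀ {n} (x y : Vec ℕ n) → Vec.sum (Vec.zipWith _+_ x y) ≡ Vec.sum x + Vec.sum y
sum-zipWith-+ []      []      = refl
sum-zipWith-+ (a ∷ x) (b ∷ y) = trans (cong (a + b +_) (sum-zipWith-+ x y)) (+-interchange a b _ _)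

sum-replicate-0 : ∀ n → Vec.sum (Vec.replicate n 0) ≡ 0
sum-replicate-0 zero    = refl
sum-replicate-0 (suc n) = sum-replicate-0 n

sum-updateAt-suc : ∀ {n} (m : Vec ℕ n) j → Vec.sum (m [ j ]%= suc) ≡ suc (Vec.sum m)
sum-updateAt-suc (x ∷ m) zero    = refl
sum-updateAt-suc (x ∷ m) (suc j) = trans (cong (x +_) (sum-updateAt-suc m j)) (+-suc x (Vec.sum m))

sum-unitExp : ∀ {n} (j : Fin n) → Vec.sum (unitExp j) ≡ 1
sum-unitExp {n} j = begin
  Vec.sum (unitExp j)                                           ≡⟨ cong Vec.sum (zipWith-+-identityʳ (unitExp j)) ⟨
  Vec.sum (Vec.zipWith _+_ (unitExp j) (Vec.replicate n 0))     ≡⟨ cong Vec.sum (unitExp-+ j (Vec.replicate n 0)) ⟩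
  Vec.sum (Vec.replicate n 0 [ j ]%= suc)                       ≡⟨ sum-updateAt-suc (Vec.replicate n 0) j ⟩
  suc (Vec.sum (Vec.replicate n 0))                             ≡⟨ cong suc (sum-replicate-0 n) ⟩
  1                                                             ∎
  where open ≡-Reasoning

lookup-tabulate-< : ∀ {n p} (f : Fin n → ℕ) → (∀ i → f i < p) → ∀ i → Vec.lookup (Vec.tabulate f) i < p
lookup-tabulate-< {p = p} f fᵢ<p i = subst (_< p) (sym (Vecₚ.lookup∘tabulate f i)) (fᵢ<p i)

sum-tabulate : ∀ {n} (f : Fin n → ℕ) → Vec.sum (Vec.tabulate f) ≡ sumFin f
sum-tabulate {zero}  f = refl
sum-tabulate {suc n} f = cong (f zero +_) (sum-tabulate (f ∘ suc))

sumOver : {A : Set} → (A → ℕ) → List A → ℕ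
sumOver f xs = sum (List.map f xs)

sumOver-tabulate : ∀ {A : Set} {n} (h : A → ℕ) (F : Fin n → A) → sumOver h (List.tabulate F) ≡ sumFin (h ∘ F)
sumOver-tabulate h F = cong sum (Listₚ.map-tabulate F h)

sumOver-cong : ∀ {A : Set} {f g : A → ℕ} → (∀ x → f x ≡ g x) → ∀ xs → sumOver f xs ≡ sumOver g xs
sumOver-cong f≗g xs = cong sum (Listₚ.map-cong f≗g xs)

sumOver-cong-local : ∀ {A : Set} {f g : A → ℕ} {xs} → All (λ x → f x ≡ g x) xs → sumOver f xs ≡ sumOver g xs
sumOver-cong-local fxs≡gxs = cong sum (Listₚ.map-cong-local fxs≡gxs)

sumOver-map : ∀ {A B : Set} (f : B → ℕ) (h : A → B) xs → sumOver f (List.map h xs) ≡ sumOver (f ∘ h) xs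
sumOver-map f h xs = cong sum (sym (Listₚ.map-∘ xs))

*-distribˡ-sumOver : ∀ {A : Set} c (f : A → ℕ) xs → c * sumOver f xs ≡ sumOver (λ x → c * f x) xs
*-distribˡ-sumOver c f []       = *-zeroʳ c
*-distribˡ-sumOver c f (x ∷ xs) = trans (*-distribˡ-+ c (f x) _) (cong (c * f x +_) (*-distribˡ-sumOver c f xs))

sumOver-+ : ∀ {A : Set} (f g : A → ℕ) xs → sumOver (λ x → f x + g x) xs ≡ sumOver f xs + sumOver g xs
sumOver-+ f g []       = refl
sumOver-+ f g (x ∷ xs) = trans (cong (f x + g x +_) (sumOver-+ f g xs)) (+-interchange (f x) (g x) _ _)

sumOver-zero : ∀ {A : Set} (xs : List A) → sumOver (λ _ → 0) xs ≡ 0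
sumOver-zero []       = refl
sumOver-zero (x ∷ xs) = sumOver-zero xs

sumOver-swap : ∀ {A B : Set} (f : A → B → ℕ) xs ys →
               sumOver (λ x → sumOver (f x) ys) xs ≡ sumOver (λ y → sumOver (λ x → f x y) xs) ys
sumOver-swap f []       ys = sym (sumOver-zero ys)
sumOver-swap f (x ∷ xs) ys = trans (cong (sumOver (f x) ys +_) (sumOver-swap f xs ys))
                                   (sym (sumOver-+ (f x) (λ y → sumOver (λ x → f x y) xs) ys))

sumFin-cong : ∀ {n} {f g : Fin n → ℕ} → (∀ j → f j ≡ g j) → sumFin f ≡ sumFin g
sumFin-cong f≗g = cong sum (Listₚ.tabulate-cong f≗g)

*-distribˡ-sumFin : ∀ {n} c (f : Fin n → ℕ) → c * sumFin f ≡ sumFin (λ j → c * f j)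
*-distribˡ-sumFin {zero}  c f = *-zeroʳ c
*-distribˡ-sumFin {suc n} c f = trans (*-distribˡ-+ c (f zero) _) (cong (c * f zero +_) (*-distribˡ-sumFin c (f ∘ suc)))

coeff-++ : ∀ {n} (m : Vec ℕ n) f g → coeff m (f ++ g) ≡ coeff m f + coeff m g
coeff-++ m []            g = refl
coeff-++ m ((c , e) ∷ f) g with Vecₚ.≡-dec _≟_ e m
... | yes _ = trans (cong (c +_) (coeff-++ m f g)) (sym (+-assoc c _ _))
... | no  _ = coeff-++ m f g

coeff-mul : ∀ {n} (m : Vec ℕ n) f g → coeff m (mul f g) ≡ sumOver (λ t → coeff m (List.map (mulTerm t) g)) f
coeff-mul m []      g = refl
coeff-mul m (t ∷ f) g = trans (coeff-++ m (List.map (mulTerm t) g) (mul f g)) (cong (coeff m (List.map (mulTerm t) g) +_) (coeff-mul m f g))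

coeff-mul-linForm : ∀ {n} (m : Vec ℕ n) (c : Fin n → ℕ) g →
                    coeff m (mul (linForm c) g) ≡ sumFin (λ j → coeff m (List.map (mulTerm (c j , unitExp j)) g))
coeff-mul-linForm m c g = trans (coeff-mul m (linForm c) g) (sumOver-tabulate _ (λ j → c j , unitExp j))

coeff-shift : ∀ {n} (m : Vec ℕ n) c j g → coeff (m [ j ]%= suc) (List.map (mulTerm (c , unitExp j)) g) ≡ c * coeff m g
coeff-shift m c j []            = sym (*-zeroʳ c)
coeff-shift m c j ((d , e) ∷ g)
  with Vecₚ.≡-dec _≟_ (Vec.zipWith _+_ (unitExp j) e) (m [ j ]%= suc) | Vecₚ.≡-dec _≟_ e m
... | yes _  | yes _    = trans (cong (c * d +_) (coeff-shift m c j g)) (sym (*-distribˡ-+ c d (coeff m g)))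
... | yes eq | no e≢m   = contradiction (updateAt-suc-injective j (trans (sym (unitExp-+ j e)) eq)) e≢m
... | no ne  | yes refl = contradiction (unitExp-+ j e) ne
... | no _   | no _     = coeff-shift m c j g

coeff-shift-absent : ∀ {n} (m : Vec ℕ n) c j g → Vec.lookup m j ≡ 0 → coeff m (List.map (mulTerm (c , unitExp j)) g) ≡ 0
coeff-shift-absent m c j []            mⱼ≡0 = refl
coeff-shift-absent m c j ((d , e) ∷ g) mⱼ≡0 with Vecₚ.≡-dec _≟_ (Vec.zipWith _+_ (unitExp j) e) m
... | yes refl = contradiction (trans (sym lookup-shifted) mⱼ≡0) 1+n≢0
  where
  lookup-shifted : Vec.lookup (Vec.zipWith _+_ (unitExp j) e) j ≡ suc (Vec.lookup e j)
  lookup-shifted = trans (cong (λ v → Vec.lookup v j) (unitExp-+ j e)) (Vecₚ.lookup∘updateAt j e)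
... | no _     = coeff-shift-absent m c j g mⱼ≡0

coeff-one-replicate-0 : ∀ n → coeff (Vec.replicate n 0) one ≡ 1
coeff-one-replicate-0 n with Vecₚ.≡-dec _≟_ (Vec.replicate n 0) (Vec.replicate n 0)
... | yes _  = refl
... | no  ne = contradiction refl ne

coeff-one-updateAt-suc : ∀ {n} (m : Vec ℕ n) k → coeff (m [ k ]%= suc) one ≡ 0
coeff-one-updateAt-suc {n} m k with Vecₚ.≡-dec _≟_ (Vec.replicate n 0) (m [ k ]%= suc)
... | yes eq = contradiction (trans (sym (Vecₚ.lookup-replicate k 0)) (trans (cong (λ v → Vec.lookup v k) eq) (Vecₚ.lookup∘updateAt k m))) 0≢1+n
... | no  _  = refl

linProd : ∀ {n} → (Fin n → Fin n → ℕ) → List (Fin n) → Poly n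
linProd w ρ = prod (List.map (λ i → linForm (w i)) ρ)

replicateEach : ∀ {n} → (Fin n → ℕ) → List (Fin n)
replicateEach r = List.concat (List.tabulate (λ i → List.replicate (r i) i))

prodFin-pow≡linProd : ∀ {n} (w : Fin n → Fin n → ℕ) (r : Fin n → ℕ) →
                      prodFin (λ i → pow (linForm (w i)) (r i)) ≡ linProd w (replicateEach r)
prodFin-pow≡linProd {n} w r = begin
  prod (List.tabulate (λ i → pow (L i) (r i)))
    ≡⟨ cong prod (Listₚ.tabulate-cong (λ i → pow≡prod-replicate (L i) (r i))) ⟩
  prod (List.tabulate (λ i → prod (List.replicate (r i) (L i))))
    ≡⟨ cong prod (Listₚ.map-tabulate (λ i → List.replicate (r i) (L i)) prod) ⟨
  prod (List.map prod (List.tabulate (λ i → List.replicate (r i) (L i))))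
    ≡⟨ prod-concat (List.tabulate (λ i → List.replicate (r i) (L i))) ⟨
  prod (List.concat (List.tabulate (λ i → List.replicate (r i) (L i))))
    ≡⟨ cong (prod ∘ List.concat) (Listₚ.tabulate-cong (λ i → Listₚ.map-replicate L (r i) i)) ⟨
  prod (List.concat (List.tabulate (λ i → List.map L (List.replicate (r i) i))))
    ≡⟨ cong (prod ∘ List.concat) (Listₚ.map-tabulate (λ i → List.replicate (r i) i) (List.map L)) ⟨
  prod (List.concat (List.map (List.map L) (List.tabulate (λ i → List.replicate (r i) i))))
    ≡⟨ cong prod (Listₚ.concat-map (List.tabulate (λ i → List.replicate (r i) i))) ⟩
  linProd w (replicateEach r)
    ∎
  where
  open ≡-Reasoning
  L : Fin n → Poly n
  L i = linForm (w i)

picks : ∀ {A : Set} → List A → List (A × List A)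
picks []       = []
picks (x ∷ xs) = (x , xs) ∷ List.map (map₂ (x ∷_)) (picks xs)

length-picks : ∀ {A : Set} (xs : List A) → All (λ u → suc (length (proj₂ u)) ≡ length xs) (picks xs)
length-picks []       = []
length-picks (x ∷ xs) = refl ∷ Allₚ.map⁺ (All.map (cong suc) (length-picks xs))

permanent : ∀ {X Y : Set} → (X → Y → ℕ) → List X → List Y → ℕ
permanent w []      []      = 1
permanent w []      (_ ∷ _) = 0
permanent w (i ∷ ρ) σ       = sumOver (λ u → w i (proj₁ u) * permanent w ρ (proj₂ u)) (picks σ)

permanent-∷-∷ : ∀ {X Y : Set} (w : X → Y → ℕ) i ρ k σ →
                permanent w (i ∷ ρ) (k ∷ σ) ≡ w i k * permanent w ρ σ + sumOver (λ u → w i (proj₁ u) * permanent w ρ (k ∷ proj₂ u)) (picks σ)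
permanent-∷-∷ w i ρ k σ = cong (w i k * permanent w ρ σ +_) (sumOver-map _ (map₂ (k ∷_)) (picks σ))

module _ {X Y : Set} (w : X → Y → ℕ) where

  permanent-transpose-≤ : ∀ N ρ σ → length ρ ≤ N → permanent w ρ σ ≡ permanent (flip w) σ ρ
  permanent-transpose-≤ N       []      []      _            = refl
  permanent-transpose-≤ N       []      (k ∷ σ) _            = refl
  permanent-transpose-≤ N       (i ∷ ρ) []      _            = refl
  permanent-transpose-≤ (suc N) (i ∷ ρ) (k ∷ σ) (s≤s |ρ|≤N) = begin
    permanent w (i ∷ ρ) (k ∷ σ)
      ≡⟨ permanent-∷-∷ w i ρ k σ ⟩
    w i k * permanent w ρ σ + sumOver (λ u → w i (proj₁ u) * permanent w ρ (k ∷ proj₂ u)) (picks σ)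
      ≡⟨ cong₂ _+_ (cong (w i k *_) (IH ρ σ |ρ|≤N)) cross-terms ⟩
    w i k * permanent (flip w) σ ρ + sumOver (λ v → w (proj₁ v) k * permanent (flip w) σ (i ∷ proj₂ v)) (picks ρ)
      ≡⟨ permanent-∷-∷ (flip w) k σ i ρ ⟨
    permanent (flip w) (k ∷ σ) (i ∷ ρ)
      ∎
    where
    open ≡-Reasoning
    IH : ∀ ρ σ → length ρ ≤ N → permanent w ρ σ ≡ permanent (flip w) σ ρ
    IH = permanent-transpose-≤ N

    |v₂|<|ρ| : All (λ v → suc (length (proj₂ v)) ≤ N) (picks ρ)
    |v₂|<|ρ| = All.map (λ eq → subst (_≤ N) (sym eq) |ρ|≤N) (length-picks ρ)

    cross-terms : sumOver (λ u → w i (proj₁ u) * permanent w ρ (k ∷ proj₂ u)) (picks σ)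
                ≡ sumOver (λ v → w (proj₁ v) k * permanent (flip w) σ (i ∷ proj₂ v)) (picks ρ)
    cross-terms = begin
      sumOver (λ u → w i (proj₁ u) * permanent w ρ (k ∷ proj₂ u)) (picks σ)
        ≡⟨ sumOver-cong (λ u → cong (w i (proj₁ u) *_) (IH ρ (k ∷ proj₂ u) |ρ|≤N)) (picks σ) ⟩
      sumOver (λ u → w i (proj₁ u) * sumOver (λ v → w (proj₁ v) k * permanent (flip w) (proj₂ u) (proj₂ v)) (picks ρ)) (picks σ)
        ≡⟨ sumOver-cong (λ u → *-distribˡ-sumOver (w i (proj₁ u)) _ (picks ρ)) (picks σ) ⟩
      sumOver (λ u → sumOver (λ v → w i (proj₁ u) * (w (proj₁ v) k * permanent (flip w) (proj₂ u) (proj₂ v))) (picks ρ)) (picks σ)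
        ≡⟨ sumOver-swap _ (picks σ) (picks ρ) ⟩
      sumOver (λ v → sumOver (λ u → w i (proj₁ u) * (w (proj₁ v) k * permanent (flip w) (proj₂ u) (proj₂ v))) (picks σ)) (picks ρ)
        ≡⟨ sumOver-cong-local (All.map (λ {v} |v₂|<N → sumOver-cong (λ u →
             trans (*-left-comm (w i (proj₁ u)) (w (proj₁ v) k) _)
                   (cong (λ z → w (proj₁ v) k * (w i (proj₁ u) * z)) (sym (IH (proj₂ v) (proj₂ u) (<⇒≤ |v₂|<N))))) (picks σ)) |v₂|<|ρ|) ⟩
      sumOver (λ v → sumOver (λ u → w (proj₁ v) k * (w i (proj₁ u) * permanent w (proj₂ v) (proj₂ u))) (picks σ)) (picks ρ)
        ≡⟨ sumOver-cong (λ v → *-distribˡ-sumOver (w (proj₁ v) k) _ (picks σ)) (picks ρ) ⟨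
      sumOver (λ v → w (proj₁ v) k * permanent w (i ∷ proj₂ v) σ) (picks ρ)
        ≡⟨ sumOver-cong-local (All.map (λ {v} |v₂|<N → cong (w (proj₁ v) k *_) (IH (i ∷ proj₂ v) σ |v₂|<N)) |v₂|<|ρ|) ⟩
      sumOver (λ v → w (proj₁ v) k * permanent (flip w) σ (i ∷ proj₂ v)) (picks ρ)
        ∎

  permanent-transpose : ∀ ρ σ → permanent w ρ σ ≡ permanent (flip w) σ ρ
  permanent-transpose ρ σ = permanent-transpose-≤ (length ρ) ρ σ ≤-refl

multiplicities : ∀ {n} → List (Fin n) → Vec ℕ n
multiplicities []      = Vec.replicate _ 0
multiplicities (k ∷ σ) = multiplicities σ [ k ]%= suc

sumFin-replicate-0 : ∀ n (h : Fin n → ℕ) → sumFin (λ j → Vec.lookup (Vec.replicate n 0) j * h j) ≡ 0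
sumFin-replicate-0 zero    h = refl
sumFin-replicate-0 (suc n) h = sumFin-replicate-0 n (h ∘ suc)

sumFin-updateAt-suc : ∀ {n} (m : Vec ℕ n) k (h : Fin n → ℕ) →
                      sumFin (λ j → Vec.lookup (m [ k ]%= suc) j * h j) ≡ h k + sumFin (λ j → Vec.lookup m j * h j)
sumFin-updateAt-suc (x ∷ m) zero    h = +-assoc (h zero) (x * h zero) _
sumFin-updateAt-suc (x ∷ m) (suc k) h =
  trans (cong (x * h zero +_) (sumFin-updateAt-suc m k (h ∘ suc))) (+-left-comm (x * h zero) (h (suc k)) _)

sumOver-picks : ∀ {n} (σ : List (Fin n)) (g : Fin n → Vec ℕ n → ℕ) →
                sumOver (λ u → g (proj₁ u) (multiplicities (proj₂ u))) (picks σ)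
                ≡ sumFin (λ j → Vec.lookup (multiplicities σ) j * g j (multiplicities σ [ j ]%= pred))
sumOver-picks {n} []      g = sym (sumFin-replicate-0 n _)
sumOver-picks {n} (k ∷ τ) g = begin
  g k T + sumOver (λ u → g (proj₁ u) (multiplicities (proj₂ u))) (List.map (map₂ (k ∷_)) (picks τ))
    ≡⟨ cong (g k T +_) (trans (sumOver-map _ _ (picks τ)) (sumOver-picks τ (λ j v → g j (v [ k ]%= suc)))) ⟩
  g k T + sumFin (λ j → Vec.lookup T j * g j ((T [ j ]%= pred) [ k ]%= suc))
    ≡⟨ cong₂ _+_ (cong (g k) (sym (updateAt-pred∘suc T k)))
                 (sumFin-cong (λ j → commute j (Vec.lookup T j) refl)) ⟩
  g k ((T [ k ]%= suc) [ k ]%= pred) + sumFin (λ j → Vec.lookup T j * g j ((T [ k ]%= suc) [ j ]%= pred))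
    ≡⟨ sumFin-updateAt-suc T k (λ j → g j ((T [ k ]%= suc) [ j ]%= pred)) ⟨
  sumFin (λ j → Vec.lookup (T [ k ]%= suc) j * g j ((T [ k ]%= suc) [ j ]%= pred))
    ∎
  where
  open ≡-Reasoning
  T : Vec ℕ n
  T = multiplicities τ
  commute : ∀ j l → Vec.lookup T j ≡ l → l * g j ((T [ j ]%= pred) [ k ]%= suc) ≡ l * g j ((T [ k ]%= suc) [ j ]%= pred)
  commute j zero    _      = refl
  commute j (suc l) Tⱼ≡1+l = cong (λ v → suc l * g j v) (updateAt-pred-suc-comm T j k Tⱼ≡1+l)

infix 8 _!ᵛ

_!ᵛ : ∀ {n} → Vec ℕ n → ℕ
[]      !ᵛ = 1
(x ∷ m) !ᵛ = x ! * m !ᵛ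

replicate-0-!ᵛ : ∀ n → Vec.replicate n 0 !ᵛ ≡ 1
replicate-0-!ᵛ zero    = refl
replicate-0-!ᵛ (suc n) = trans (+-identityʳ _) (replicate-0-!ᵛ n)

updateAt-suc-!ᵛ : ∀ {n} (m : Vec ℕ n) j → (m [ j ]%= suc) !ᵛ ≡ suc (Vec.lookup m j) * m !ᵛ
updateAt-suc-!ᵛ (x ∷ m) zero    = *-assoc (suc x) (x !) (m !ᵛ)
updateAt-suc-!ᵛ (x ∷ m) (suc j) = trans (cong (x ! *_) (updateAt-suc-!ᵛ m j)) (*-left-comm (x !) (suc (Vec.lookup m j)) (m !ᵛ))

!ᵛ*coeff-shift : ∀ {n} (m : Vec ℕ n) j c g →
                 m !ᵛ * coeff m (List.map (mulTerm (c , unitExp j)) g)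
                 ≡ Vec.lookup m j * (c * ((m [ j ]%= pred) !ᵛ * coeff (m [ j ]%= pred) g))
!ᵛ*coeff-shift {n} m j c g with Vec.lookup m j in mⱼ≡
... | zero  = trans (cong (m !ᵛ *_) (coeff-shift-absent m c j g mⱼ≡)) (*-zeroʳ (m !ᵛ))
... | suc l = begin
  m !ᵛ * coeff m (List.map (mulTerm (c , unitExp j)) g)
    ≡⟨ cong (λ v → v !ᵛ * coeff v (List.map (mulTerm (c , unitExp j)) g)) (updateAt-suc∘pred m j mⱼ≡) ⟨
  (d [ j ]%= suc) !ᵛ * coeff (d [ j ]%= suc) (List.map (mulTerm (c , unitExp j)) g)
    ≡⟨ cong₂ _*_ (updateAt-suc-!ᵛ d j) (coeff-shift d c j g) ⟩
  suc (Vec.lookup d j) * d !ᵛ * (c * coeff d g)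
    ≡⟨ cong (λ x → suc x * d !ᵛ * (c * coeff d g)) dⱼ≡l ⟩
  suc l * d !ᵛ * (c * coeff d g)
    ≡⟨ solve 4 (λ a f c x → a :* f :* (c :* x) := a :* (c :* (f :* x))) refl (suc l) (d !ᵛ) c (coeff d g) ⟩
  suc l * (c * (d !ᵛ * coeff d g))
    ∎
  where
  open ≡-Reasoning
  d : Vec ℕ n
  d = m [ j ]%= pred
  dⱼ≡l : Vec.lookup d j ≡ l
  dⱼ≡l = trans (Vecₚ.lookup∘updateAt j m) (cong pred mⱼ≡)

permanent≡!ᵛ*coeff : ∀ {n} (w : Fin n → Fin n → ℕ) ρ σ →
                     permanent w ρ σ ≡ multiplicities σ !ᵛ * coeff (multiplicities σ) (linProd w ρ)
permanent≡!ᵛ*coeff {n} w []      []      = sym (cong₂ _*_ (replicate-0-!ᵛ n) (coeff-one-replicate-0 n))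
permanent≡!ᵛ*coeff     w []      (k ∷ σ) =
  sym (trans (cong (multiplicities (k ∷ σ) !ᵛ *_) (coeff-one-updateAt-suc (multiplicities σ) k)) (*-zeroʳ (multiplicities (k ∷ σ) !ᵛ)))
permanent≡!ᵛ*coeff {n} w (i ∷ ρ) σ       = begin
  sumOver (λ u → w i (proj₁ u) * permanent w ρ (proj₂ u)) (picks σ)
    ≡⟨ sumOver-cong (λ u → cong (w i (proj₁ u) *_) (permanent≡!ᵛ*coeff w ρ (proj₂ u))) (picks σ) ⟩
  sumOver (λ u → w i (proj₁ u) * (multiplicities (proj₂ u) !ᵛ * coeff (multiplicities (proj₂ u)) P)) (picks σ)
    ≡⟨ sumOver-picks σ (λ j v → w i j * (v !ᵛ * coeff v P)) ⟩
  sumFin (λ j → Vec.lookup M j * (w i j * ((M [ j ]%= pred) !ᵛ * coeff (M [ j ]%= pred) P)))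
    ≡⟨ sumFin-cong (λ j → !ᵛ*coeff-shift M j (w i j) P) ⟨
  sumFin (λ j → M !ᵛ * coeff M (List.map (mulTerm (w i j , unitExp j)) P))
    ≡⟨ *-distribˡ-sumFin (M !ᵛ) (λ j → coeff M (List.map (mulTerm (w i j , unitExp j)) P)) ⟨
  M !ᵛ * sumFin (λ j → coeff M (List.map (mulTerm (w i j , unitExp j)) P))
    ≡⟨ cong (M !ᵛ *_) (coeff-mul-linForm M (w i) P) ⟨
  M !ᵛ * coeff M (linProd w (i ∷ ρ))
    ∎
  where
  open ≡-Reasoning
  M : Vec ℕ n
  M = multiplicities σ
  P : Poly n
  P = linProd w ρ

sum-multiplicities : ∀ {n} (σ : List (Fin n)) → Vec.sum (multiplicities σ) ≡ length σ
sum-multiplicities {n} []      = sum-replicate-0 n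
sum-multiplicities     (k ∷ σ) = trans (sum-updateAt-suc (multiplicities σ) k) (cong suc (sum-multiplicities σ))

multiplicities-map-suc : ∀ {n} (xs : List (Fin n)) → multiplicities (List.map suc xs) ≡ 0 ∷ multiplicities xs
multiplicities-map-suc []       = refl
multiplicities-map-suc (x ∷ xs) = cong (_[ suc x ]%= suc) (multiplicities-map-suc xs)

multiplicities-replicate-zero-++ : ∀ {n} k (xs : List (Fin n)) →
                                   multiplicities (List.replicate k zero ++ List.map suc xs) ≡ k ∷ multiplicities xs
multiplicities-replicate-zero-++ zero    xs = multiplicities-map-suc xs
multiplicities-replicate-zero-++ (suc k) xs = cong (_[ zero ]%= suc) (multiplicities-replicate-zero-++ k xs)

replicateEach-suc : ∀ {n} (r : Fin (suc n) → ℕ) →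
                    List.concat (List.tabulate (λ i → List.replicate (r (suc i)) (suc i))) ≡ List.map suc (replicateEach (r ∘ suc))
replicateEach-suc r = begin
  List.concat (List.tabulate (λ i → List.replicate (r (suc i)) (suc i)))
    ≡⟨ cong List.concat (Listₚ.tabulate-cong (λ i → Listₚ.map-replicate suc (r (suc i)) i)) ⟨
  List.concat (List.tabulate (λ i → List.map suc (List.replicate (r (suc i)) i)))
    ≡⟨ cong List.concat (Listₚ.map-tabulate (λ i → List.replicate (r (suc i)) i) (List.map suc)) ⟨
  List.concat (List.map (List.map suc) (List.tabulate (λ i → List.replicate (r (suc i)) i)))
    ≡⟨ Listₚ.concat-map (List.tabulate (λ i → List.replicate (r (suc i)) i)) ⟩
  List.map suc (replicateEach (r ∘ suc))
    ∎
  where open ≡-Reasoning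

multiplicities-replicateEach : ∀ {n} (r : Fin n → ℕ) → multiplicities (replicateEach r) ≡ Vec.tabulate r
multiplicities-replicateEach {zero}  r = refl
multiplicities-replicateEach {suc n} r = begin
  multiplicities (List.replicate (r zero) zero ++ List.concat (List.tabulate (λ i → List.replicate (r (suc i)) (suc i))))
    ≡⟨ cong (λ xs → multiplicities (List.replicate (r zero) zero ++ xs)) (replicateEach-suc r) ⟩
  multiplicities (List.replicate (r zero) zero ++ List.map suc (replicateEach (r ∘ suc)))
    ≡⟨ multiplicities-replicate-zero-++ (r zero) (replicateEach (r ∘ suc)) ⟩
  r zero ∷ multiplicities (replicateEach (r ∘ suc))
    ≡⟨ cong (r zero ∷_) (multiplicities-replicateEach (r ∘ suc)) ⟩
  Vec.tabulate r
    ∎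
  where open ≡-Reasoning

!ᵛ*coeff-linProd-transpose : ∀ {n} (w : Fin n → Fin n → ℕ) (r s : Fin n → ℕ) →
  Vec.tabulate s !ᵛ * coeff (Vec.tabulate s) (linProd w (replicateEach r))
  ≡ Vec.tabulate r !ᵛ * coeff (Vec.tabulate r) (linProd (flip w) (replicateEach s))
!ᵛ*coeff-linProd-transpose w r s = begin
  Vec.tabulate s !ᵛ * coeff (Vec.tabulate s) (linProd w (replicateEach r))
    ≡⟨ cong (λ m → m !ᵛ * coeff m (linProd w (replicateEach r))) (multiplicities-replicateEach s) ⟨
  multiplicities (replicateEach s) !ᵛ * coeff (multiplicities (replicateEach s)) (linProd w (replicateEach r))
    ≡⟨ permanent≡!ᵛ*coeff w (replicateEach r) (replicateEach s) ⟨
  permanent w (replicateEach r) (replicateEach s)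
    ≡⟨ permanent-transpose w (replicateEach r) (replicateEach s) ⟩
  permanent (flip w) (replicateEach s) (replicateEach r)
    ≡⟨ permanent≡!ᵛ*coeff (flip w) (replicateEach s) (replicateEach r) ⟩
  multiplicities (replicateEach r) !ᵛ * coeff (multiplicities (replicateEach r)) (linProd (flip w) (replicateEach s))
    ≡⟨ cong (λ m → m !ᵛ * coeff m (linProd (flip w) (replicateEach s))) (multiplicities-replicateEach r) ⟩
  Vec.tabulate r !ᵛ * coeff (Vec.tabulate r) (linProd (flip w) (replicateEach s))
    ∎
  where open ≡-Reasoning

length-replicateEach : ∀ {n} (r : Fin n → ℕ) → length (replicateEach r) ≡ sumFin r
length-replicateEach r = begin
  length (replicateEach r)                   ≡⟨ sum-multiplicities (replicateEach r) ⟨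
  Vec.sum (multiplicities (replicateEach r)) ≡⟨ cong Vec.sum (multiplicities-replicateEach r) ⟩
  Vec.sum (Vec.tabulate r)                   ≡⟨ sum-tabulate r ⟩
  sumFin r                                   ∎
  where open ≡-Reasoning

Homogeneous : ∀ {n} → ℕ → Poly n → Set
Homogeneous d f = All (λ t → Vec.sum (proj₂ t) ≡ d) f

homogeneous-mul : ∀ {n a b} {f g : Poly n} → Homogeneous a f → Homogeneous b g → Homogeneous (a + b) (mul f g)
homogeneous-mul {f = []}          []        hg = []
homogeneous-mul {f = (c , e) ∷ f} (he ∷ hf) hg =
  Allₚ.++⁺ (Allₚ.map⁺ (All.map (λ {u} hu → trans (sum-zipWith-+ e (proj₂ u)) (cong₂ _+_ he hu)) hg)) (homogeneous-mul hf hg)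

homogeneous-linForm : ∀ {n} (c : Fin n → ℕ) → Homogeneous 1 (linForm c)
homogeneous-linForm c = Allₚ.tabulate⁺ sum-unitExp

homogeneous-linProd : ∀ {n} (w : Fin n → Fin n → ℕ) ρ → Homogeneous (length ρ) (linProd w ρ)
homogeneous-linProd {n} w []      = sum-replicate-0 n ∷ []
homogeneous-linProd     w (i ∷ ρ) = homogeneous-mul (homogeneous-linForm (w i)) (homogeneous-linProd w ρ)

redExp-≤ : ∀ p e → redExp p e ≤ e
redExp-≤ p zero    = z≤n
redExp-≤ p (suc e) with p ∸ 1
... | zero  = ≤-refl
... | suc q = s≤s (m%n≤m e (suc q))

redExp-< : ∀ p e → e < p → redExp p e ≡ e
redExp-< p zero    _   = refl
redExp-< p (suc e) e<p with p ∸ 1 in p-1≡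
... | zero  = refl
... | suc q = cong suc (m<n⇒m%n≡m (subst (e <_) p-1≡ (∸-monoˡ-< e<p (s≤s z≤n))))

sum-map-redExp-≤ : ∀ {n} p (e : Vec ℕ n) → Vec.sum (Vec.map (redExp p) e) ≤ Vec.sum e
sum-map-redExp-≤ p []      = z≤n
sum-map-redExp-≤ p (x ∷ e) = +-mono-≤ (redExp-≤ p x) (sum-map-redExp-≤ p e)

sum-map-redExp⇒map-redExp-id : ∀ {n} p (e : Vec ℕ n) → Vec.sum (Vec.map (redExp p) e) ≡ Vec.sum e → Vec.map (redExp p) e ≡ e
sum-map-redExp⇒map-redExp-id p []      _  = refl
sum-map-redExp⇒map-redExp-id p (x ∷ e) eq = cong₂ _∷_ x′≡x (sum-map-redExp⇒map-redExp-id p e e′≡e)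
  where
  x′≡x : redExp p x ≡ x
  x′≡x = ≤-antisym (redExp-≤ p x)
    (+-cancelʳ-≤ (Vec.sum e) x (redExp p x) (≤-trans (≤-reflexive (sym eq)) (+-monoʳ-≤ (redExp p x) (sum-map-redExp-≤ p e))))
  e′≡e : Vec.sum (Vec.map (redExp p) e) ≡ Vec.sum e
  e′≡e = +-cancelˡ-≡ x _ _ (trans (cong (_+ Vec.sum (Vec.map (redExp p) e)) (sym x′≡x)) eq)

map-redExp-< : ∀ {n} p (m : Vec ℕ n) → (∀ i → Vec.lookup m i < p) → Vec.map (redExp p) m ≡ m
map-redExp-< p []      _     = refl
map-redExp-< p (x ∷ m) mᵢ<p = cong₂ _∷_ (redExp-< p x (mᵢ<p zero)) (map-redExp-< p m (mᵢ<p ∘ suc))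

coeff-reduce : ∀ {n} p (m : Vec ℕ n) → (∀ i → Vec.lookup m i < p) → ∀ {f} → Homogeneous (Vec.sum m) f →
               coeff m (reduce p f) ≡ coeff m f
coeff-reduce p m mᵢ<p {[]}          []        = refl
coeff-reduce p m mᵢ<p {(c , e) ∷ f} (he ∷ hf) with Vecₚ.≡-dec _≟_ (Vec.map (redExp p) e) m | Vecₚ.≡-dec _≟_ e m
... | yes _  | yes _    = cong (c +_) (coeff-reduce p m mᵢ<p hf)
... | yes e′≡m | no e≢m = contradiction (trans (sym (sum-map-redExp⇒map-redExp-id p e (trans (cong Vec.sum e′≡m) (sym he)))) e′≡m) e≢m
... | no e′≢m | yes refl = contradiction (map-redExp-< p e mᵢ<p) e′≢m
... | no _   | no _     = coeff-reduce p m mᵢ<p hf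

coeff-reduce-prodFin-pow : ∀ {n} p (w : Fin n → Fin n → ℕ) (r s : Fin n → ℕ) → (∀ i → s i < p) → sumFin s ≡ sumFin r →
  coeff (Vec.tabulate s) (reduce p (prodFin (λ i → pow (linForm (w i)) (r i))))
  ≡ coeff (Vec.tabulate s) (linProd w (replicateEach r))
coeff-reduce-prodFin-pow p w r s sᵢ<p Σs≡Σr = begin
  coeff (Vec.tabulate s) (reduce p (prodFin (λ i → pow (linForm (w i)) (r i))))
    ≡⟨ cong (coeff (Vec.tabulate s) ∘ reduce p) (prodFin-pow≡linProd w r) ⟩
  coeff (Vec.tabulate s) (reduce p (linProd w (replicateEach r)))
    ≡⟨ coeff-reduce p (Vec.tabulate s) (lookup-tabulate-< s sᵢ<p) homogeneous ⟩
  coeff (Vec.tabulate s) (linProd w (replicateEach r))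
    ∎
  where
  open ≡-Reasoning
  degree : length (replicateEach r) ≡ Vec.sum (Vec.tabulate s)
  degree = trans (length-replicateEach r) (trans (sym Σs≡Σr) (sym (sum-tabulate s)))
  homogeneous : Homogeneous (Vec.sum (Vec.tabulate s)) (linProd w (replicateEach r))
  homogeneous = subst (λ d → Homogeneous d (linProd w (replicateEach r))) degree (homogeneous-linProd w (replicateEach r))

prime∤! : ∀ {p} → Prime p → ∀ {x} → x < p → p ∤ x !
prime∤! pp {zero}  _   p∣1  = nonTrivial⇒≢1 {{prime⇒nonTrivial pp}} (∣1⇒≡1 p∣1)
prime∤! pp {suc x} x<p p∣x! with euclidsLemma (suc x) (x !) pp p∣x!
... | inj₁ p∣1+x = >⇒∤ x<p p∣1+x
... | inj₂ p∣x!′ = prime∤! pp (<-trans (n<1+n x) x<p) p∣x!′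

prime∤!ᵛ : ∀ {p} → Prime p → ∀ {n} (m : Vec ℕ n) → (∀ i → Vec.lookup m i < p) → p ∤ m !ᵛ
prime∤!ᵛ pp []      _    p∣1  = nonTrivial⇒≢1 {{prime⇒nonTrivial pp}} (∣1⇒≡1 p∣1)
prime∤!ᵛ pp (x ∷ m) mᵢ<p p∣m! with euclidsLemma (x !) (m !ᵛ) pp p∣m!
... | inj₁ p∣x! = prime∤! pp (mᵢ<p zero) p∣x!
... | inj₂ p∣m!′ = prime∤!ᵛ pp m (mᵢ<p ∘ suc) p∣m!′

prime∣-transfer : ∀ {p a b x y} → Prime p → p ∤ b → a * x ≡ b * y → p ∣ x → p ∣ y
prime∣-transfer {p} {a} {b} pp p∤b ax≡by p∣x with euclidsLemma b _ pp (subst (p ∣_) ax≡by (∣n⇒∣m*n a p∣x))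
... | inj₁ p∣b = contradiction p∣b p∤b
... | inj₂ p∣y = p∣y

prime∣-⇔ : ∀ {p a b x y} → Prime p → p ∤ a → p ∤ b → a * x ≡ b * y → p ∣ x ⇔ p ∣ y
prime∣-⇔ {a = a} {b} pp p∤a p∤b ax≡by = mk⇔ (prime∣-transfer {a = a} pp p∤b ax≡by) (prime∣-transfer {a = b} pp p∤a (sym ax≡by))

lemma9 : (p : ℕ) (pp : Prime p) (n : ℕ) → 1 ≤ n →
         (a : Fin n → Fin n → Fin p) → Nonsingular p pp a →
         (r s : Fin n → ℕ) → (∀ i → r i < p) → (∀ i → s i < p) →
         sumFin s ≡ sumFin r →
         IsZeroMod p (coeff (tabulate s)
           (reduce p (prodFin (λ i → pow (linForm (λ j → toℕ (a i j))) (r i)))))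
         ⇔
         IsZeroMod p (coeff (tabulate r)
           (reduce p (prodFin (λ j → pow (linForm (λ i → toℕ (a i j))) (s j)))))
lemma9 p pp n _ a _ r s rᵢ<p sᵢ<p Σs≡Σr =
  subst₂ (λ Cₛ Cᵣ → p ∣ Cₛ ⇔ p ∣ Cᵣ)
    (sym (coeff-reduce-prodFin-pow p w r s sᵢ<p Σs≡Σr))
    (sym (coeff-reduce-prodFin-pow p (flip w) s r rᵢ<p (sym Σs≡Σr)))
    (prime∣-⇔ pp (prime∤!ᵛ pp (tabulate s) (lookup-tabulate-< s sᵢ<p)) (prime∤!ᵛ pp (tabulate r) (lookup-tabulate-< r rᵢ<p))
              (!ᵛ*coeff-linProd-transpose w r s))
  where
  w : Fin n → Fin n → ℕ
  w i j = toℕ (a i j)
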